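{- Let $G_1=(V_1,E_1)$ and $G_2=(V_2,E_2)$ be finite simple graphs, let $G_1G_2$ denote their disjoint union, let $n\ge|V_1|+|V_2|$, let $f:G_1G_2\to K_n$ be a homomorphism, and let $f_i:G_i\to K_n$ be the restriction of $f$ to $V_i$. Then $r(f)\ge r(f_1)+r(f_2)$.
   Context: $K_n$ is the complete graph on $[n]$ without loops; a homomorphism $f:G\to K_n$ is a map $V(G)\to[n]$ sending adjacent vertices to distinct vertices. An edge $e=xy$ of $K_n$ is $f$-odd if the number of edges $uv\in E(G)$ with $\{f(u),f(v)\}=\{x,y\}$ is odd; a vertex of $K_n$ is $f$-odd if it is incident with an $f$-odd edge. Let $V_{\mathrm{odd}}(f)$ be the set of $f$-odd vertices and $r(f)=|V(G)|-|f(V(G))|+\frac12|V_{\mathrm{odd}}(f)|$. -}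

module Defs where

open import Data.Nat using (ℕ; zero; suc; _+_; _*_; _∸_; _%_; _≡ᵇ_; _<ᵇ_)
open import Data.Bool using (Bool; true; false; _∧_; _∨_; not; if_then_else_)
open import Data.Fin using (Fin; toℕ; splitAt; _↑ˡ_; _↑ʳ_)
open import Data.Fin.Properties using (_≟_)
open import Data.Sum using (inj₁; inj₂)
open import Relation.Nullary.Decidable using (⌊_⌋)
open import Relation.Binary.PropositionalEquality using (_≡_; _≢_)

record Graph : Set where
  field
    size   : ℕ
    adj    : Fin size → Fin size → Bool
    adj-sym    : ∀ u v → adj u v ≡ adj v u
    adj-irrefl : ∀ u → adj u u ≡ false
open Graph public

count : (k : ℕ) → (Fin k → Bool) → ℕ
count zero    p = 0
count (suc k) p = (if p Fin.zero then 1 else 0) + count k (λ i → p (Fin.suc i))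

anyF : (k : ℕ) → (Fin k → Bool) → Bool
anyF zero    p = false
anyF (suc k) p = p Fin.zero ∨ anyF k (λ i → p (Fin.suc i))

_==_ : ∀ {k} → Fin k → Fin k → Bool
i == j = ⌊ i ≟ j ⌋

IsHom : (G : Graph) (n : ℕ) → (Fin (size G) → Fin n) → Set
IsHom G n f = ∀ u v → adj G u v ≡ true → f u ≢ f v

disjAdj : (G₁ G₂ : Graph) → Fin (size G₁ + size G₂) → Fin (size G₁ + size G₂) → Bool
disjAdj G₁ G₂ u v with splitAt (size G₁) u | splitAt (size G₁) v
... | inj₁ a | inj₁ b = adj G₁ a b
... | inj₂ a | inj₂ b = adj G₂ a b
... | inj₁ _ | inj₂ _ = false
... | inj₂ _ | inj₁ _ = false

disjSym : (G₁ G₂ : Graph) → ∀ u v → disjAdj G₁ G₂ u v ≡ disjAdj G₁ G₂ v u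
disjSym G₁ G₂ u v with splitAt (size G₁) u | splitAt (size G₁) v
... | inj₁ a | inj₁ b = adj-sym G₁ a b
... | inj₂ a | inj₂ b = adj-sym G₂ a b
... | inj₁ _ | inj₂ _ = Relation.Binary.PropositionalEquality.refl
... | inj₂ _ | inj₁ _ = Relation.Binary.PropositionalEquality.refl

disjIrr : (G₁ G₂ : Graph) → ∀ u → disjAdj G₁ G₂ u u ≡ false
disjIrr G₁ G₂ u with splitAt (size G₁) u
... | inj₁ a = adj-irrefl G₁ a
... | inj₂ a = adj-irrefl G₂ a

_⊕_ : Graph → Graph → Graph
G₁ ⊕ G₂ = record
  { size = size G₁ + size G₂
  ; adj = disjAdj G₁ G₂
  ; adj-sym = disjSym G₁ G₂
  ; adj-irrefl = disjIrr G₁ G₂ }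

restrict₁ : (G₁ G₂ : Graph) {n : ℕ} → (Fin (size G₁ + size G₂) → Fin n) → Fin (size G₁) → Fin n
restrict₁ G₁ G₂ f u = f (u ↑ˡ size G₂)

restrict₂ : (G₁ G₂ : Graph) {n : ℕ} → (Fin (size G₁ + size G₂) → Fin n) → Fin (size G₂) → Fin n
restrict₂ G₁ G₂ f u = f (size G₁ ↑ʳ u)

sumF : (k : ℕ) → (Fin k → ℕ) → ℕ
sumF zero    g = 0
sumF (suc k) g = g Fin.zero + sumF k (λ i → g (Fin.suc i))

module _ (G : Graph) {n : ℕ} (f : Fin (size G) → Fin n) where

  edgeCount : Fin n → Fin n → ℕ
  edgeCount x y = sumF (size G) λ u → count (size G) λ v →
      (toℕ u <ᵇ toℕ v) ∧ adj G u v ∧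
      (((f u == x) ∧ (f v == y)) ∨ ((f u == y) ∧ (f v == x)))

  isOddEdge : Fin n → Fin n → Bool
  isOddEdge x y = not (x == y) ∧ (edgeCount x y % 2 ≡ᵇ 1)

  isOddVertex : Fin n → Bool
  isOddVertex x = anyF n (isOddEdge x)

  numOdd : ℕ
  numOdd = count n isOddVertex

  imageSize : ℕ
  imageSize = count n λ x → anyF (size G) λ u → f u == x

  -- twice r(f):  2 r(f) = 2(|V(G)| - |f(V(G))|) + |V_odd(f)|
  -- (|f(V(G))| ≤ |V(G)|, so truncated subtraction is exact here)
  twiceR : ℕ
  twiceR = 2 * (size G ∸ imageSize) + numOdd

module Submission where

-- Write I, I₁, I₂ for the images of f, f₁, f₂ and c = |I₁ ∩ I₂|, so that
-- I = I₁ ∪ I₂ and, by inclusion–exclusion, |I| + c = |I₁| + |I₂|.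
-- Every edge of G₁G₂ lies in G₁ or in G₂, so edge multiplicities add:
-- edgeCount f x y = edgeCount f₁ x y + edgeCount f₂ x y.  A colour outside
-- the image of a map carries no edges, hence is never odd.  Consequently a
-- colour outside I₂ is f-odd iff it is f₁-odd (and symmetrically), and every
-- odd colour lies in the corresponding image.  This gives
--   |V_odd(f₁)| + |V_odd(f₂)| ≤ |V_odd(f)| + 2c,
-- which, combined with |V(G₁G₂)| - |I| = (|V₁| - |I₁|) + (|V₂| - |I₂|) + c,
-- is exactly the claim.

open import Defs
open import Data.Nat using (ℕ; zero; suc; _+_; _*_; _∸_; _≤_; _≥_; _<ᵇ_; _%_; _≡ᵇ_; z≤n; s≤s)
open import Data.Nat.Properties
  using (≤-trans; ≤-reflexive; m≤n⇒m≤1+n; m≤m+n; +-suc; +-assoc; +-identityʳ; +-mono-≤; +-monoˡ-≤; +-monoʳ-≤; m+n∸m≡n; m≤n⇒∃[o]m+o≡n; module ≤-Reasoning)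
open import Data.Nat.Solver using (module +-*-Solver)
open import Data.Bool using (Bool; true; false; _∧_; _∨_; not; if_then_else_)
open import Data.Bool.Properties using (∨-assoc; ∨-identityʳ; ∨-zeroʳ; ∧-zeroʳ)
open import Data.Fin using (Fin; toℕ; _↑ˡ_; _↑ʳ_)
open import Data.Fin.Properties using (_≟_; splitAt-↑ˡ; splitAt-↑ʳ; toℕ-↑ˡ; toℕ-↑ʳ)
open import Data.Product using (_,_)
open import Relation.Binary.PropositionalEquality
open import Relation.Nullary using (yes; no)

_⇒ᵇ_ : ∀ {k} → (Fin k → Bool) → (Fin k → Bool) → Set
p ⇒ᵇ q = ∀ i → p i ≡ true → q i ≡ true

count-cong : ∀ k {p q : Fin k → Bool} → (∀ i → p i ≡ q i) → count k p ≡ count k q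
count-cong zero    e = refl
count-cong (suc k) e rewrite e Fin.zero = cong (_ +_) (count-cong k (λ i → e (Fin.suc i)))

count-false : ∀ k {p : Fin k → Bool} → (∀ i → p i ≡ false) → count k p ≡ 0
count-false zero    e = refl
count-false (suc k) e rewrite e Fin.zero = count-false k (λ i → e (Fin.suc i))

count-mono : ∀ k {p q : Fin k → Bool} → p ⇒ᵇ q → count k p ≤ count k q
count-mono zero    h = z≤n
count-mono (suc k) {p} {q} h with p Fin.zero in ep | q Fin.zero in eq
... | true  | true  = s≤s (count-mono k (λ i → h (Fin.suc i)))
... | false | true  = m≤n⇒m≤1+n (count-mono k (λ i → h (Fin.suc i)))
... | false | false = count-mono k (λ i → h (Fin.suc i))
... | true  | false with () ← trans (sym eq) (h Fin.zero ep)

count-∨∧ : ∀ k (p q : Fin k → Bool) →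
  count k (λ i → p i ∨ q i) + count k (λ i → p i ∧ q i) ≡ count k p + count k q
count-∨∧ zero    p q = refl
count-∨∧ (suc k) p q with count-∨∧ k (λ i → p (Fin.suc i)) (λ i → q (Fin.suc i))
... | ih with p Fin.zero | q Fin.zero
... | true  | true  = cong suc (trans (+-suc _ _) (trans (cong suc ih) (sym (+-suc _ _))))
... | true  | false = cong suc ih
... | false | true  = trans (cong suc ih) (sym (+-suc _ _))
... | false | false = ih

count-∨ : ∀ k (p q : Fin k → Bool) → count k (λ i → p i ∨ q i) ≤ count k p + count k q
count-∨ k p q = ≤-trans (m≤m+n _ _) (≤-reflexive (count-∨∧ k p q))

count-+ : ∀ m k (p : Fin (m + k) → Bool) →
  count (m + k) p ≡ count m (λ i → p (i ↑ˡ k)) + count k (λ i → p (m ↑ʳ i))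
count-+ zero    k p = refl
count-+ (suc m) k p rewrite count-+ m k (λ i → p (Fin.suc i)) =
  sym (+-assoc (if p Fin.zero then 1 else 0) _ _)

sumF-cong : ∀ k {g h : Fin k → ℕ} → (∀ i → g i ≡ h i) → sumF k g ≡ sumF k h
sumF-cong zero    e = refl
sumF-cong (suc k) e = cong₂ _+_ (e Fin.zero) (sumF-cong k (λ i → e (Fin.suc i)))

sumF-zero : ∀ k {g : Fin k → ℕ} → (∀ i → g i ≡ 0) → sumF k g ≡ 0
sumF-zero zero    e = refl
sumF-zero (suc k) e rewrite e Fin.zero = sumF-zero k (λ i → e (Fin.suc i))

sumF-+ : ∀ m k (g : Fin (m + k) → ℕ) →
  sumF (m + k) g ≡ sumF m (λ i → g (i ↑ˡ k)) + sumF k (λ i → g (m ↑ʳ i))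
sumF-+ zero    k g = refl
sumF-+ (suc m) k g rewrite sumF-+ m k (λ i → g (Fin.suc i)) = sym (+-assoc (g Fin.zero) _ _)

anyF-cong : ∀ k {p q : Fin k → Bool} → (∀ i → p i ≡ q i) → anyF k p ≡ anyF k q
anyF-cong zero    e = refl
anyF-cong (suc k) e = cong₂ _∨_ (e Fin.zero) (anyF-cong k (λ i → e (Fin.suc i)))

anyF-+ : ∀ m k (p : Fin (m + k) → Bool) →
  anyF (m + k) p ≡ anyF m (λ i → p (i ↑ˡ k)) ∨ anyF k (λ i → p (m ↑ʳ i))
anyF-+ zero    k p = refl
anyF-+ (suc m) k p rewrite anyF-+ m k (λ i → p (Fin.suc i)) = sym (∨-assoc (p Fin.zero) _ _)

anyF-false-elim : ∀ k {p : Fin k → Bool} → anyF k p ≡ false → ∀ i → p i ≡ false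
anyF-false-elim (suc k) {p} e i with p Fin.zero in eq
anyF-false-elim (suc k) e Fin.zero    | false = eq
anyF-false-elim (suc k) e (Fin.suc i) | false = anyF-false-elim k e i

anyF-false-intro : ∀ k {p : Fin k → Bool} → (∀ i → p i ≡ false) → anyF k p ≡ false
anyF-false-intro zero    e = refl
anyF-false-intro (suc k) e rewrite e Fin.zero = anyF-false-intro k (λ i → e (Fin.suc i))

==-suc : ∀ {n} (i x : Fin n) → (Fin.suc i == Fin.suc x) ≡ (i == x)
==-suc i x with i ≟ x
... | yes _ = refl
... | no  _ = refl

count-singleton : ∀ n (i : Fin n) → count n (λ x → i == x) ≤ 1
count-singleton (suc n) Fin.zero    = s≤s (≤-reflexive (count-false n (λ _ → refl)))
count-singleton (suc n) (Fin.suc i) =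
  ≤-trans (≤-reflexive (count-cong n (==-suc i))) (count-singleton n i)

image-bound : ∀ n s (g : Fin s → Fin n) → count n (λ x → anyF s (λ u → g u == x)) ≤ s
image-bound n zero    g = ≤-reflexive (count-false n (λ _ → refl))
image-bound n (suc s) g =
  ≤-trans (count-∨ n (λ x → g Fin.zero == x) (λ x → anyF s (λ u → g (Fin.suc u) == x)))
          (+-mono-≤ (count-singleton n (g Fin.zero)) (image-bound n s (λ u → g (Fin.suc u))))

module OutsideImage (H : Graph) {n : ℕ} (g : Fin (size H) → Fin n) (x : Fin n)
                    (x∉img : anyF (size H) (λ u → g u == x) ≡ false) where

  edgeCount-outside : ∀ y → edgeCount H g x y ≡ 0
  edgeCount-outside y = sumF-zero (size H) λ u → count-false (size H) λ v → noEdge u v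
    where
    noEdge : ∀ u v → ((toℕ u <ᵇ toℕ v) ∧ adj H u v ∧
                      (((g u == x) ∧ (g v == y)) ∨ ((g u == y) ∧ (g v == x)))) ≡ false
    noEdge u v rewrite anyF-false-elim (size H) x∉img u | anyF-false-elim (size H) x∉img v
                     | ∧-zeroʳ (g u == y) | ∧-zeroʳ (adj H u v) = ∧-zeroʳ (toℕ u <ᵇ toℕ v)

  notOdd-outside : isOddVertex H g x ≡ false
  notOdd-outside = anyF-false-intro n λ y →
    subst (λ e → not (x == y) ∧ (e % 2 ≡ᵇ 1) ≡ false) (sym (edgeCount-outside y)) (∧-zeroʳ _)

odd⇒inImage : (H : Graph) {n : ℕ} (g : Fin (size H) → Fin n) →
  isOddVertex H g ⇒ᵇ (λ x → anyF (size H) (λ u → g u == x))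
odd⇒inImage H g x odd with anyF (size H) (λ u → g u == x) in x∉img
... | true  = refl
... | false = trans (sym (OutsideImage.notOdd-outside H g x x∉img)) odd

<ᵇ-+ : ∀ m a b → (m + a <ᵇ m + b) ≡ (a <ᵇ b)
<ᵇ-+ zero    a b = refl
<ᵇ-+ (suc m) a b = <ᵇ-+ m a b

module DisjointUnion (G₁ G₂ : Graph) {n : ℕ} (f : Fin (size (G₁ ⊕ G₂)) → Fin n) where
  s₁ s₂ : ℕ
  s₁ = size G₁
  s₂ = size G₂

  G : Graph
  G = G₁ ⊕ G₂

  f₁ : Fin s₁ → Fin n
  f₁ = restrict₁ G₁ G₂ f

  f₂ : Fin s₂ → Fin n
  f₂ = restrict₂ G₁ G₂ f

  inI₁ inI₂ : Fin n → Bool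
  inI₁ x = anyF s₁ (λ u → f₁ u == x)
  inI₂ x = anyF s₂ (λ u → f₂ u == x)

  inBoth : Fin n → Bool
  inBoth x = inI₁ x ∧ inI₂ x

  adj-ll : ∀ a b → adj G (a ↑ˡ s₂) (b ↑ˡ s₂) ≡ adj G₁ a b
  adj-ll a b rewrite splitAt-↑ˡ s₁ a s₂ | splitAt-↑ˡ s₁ b s₂ = refl

  adj-rr : ∀ a b → adj G (s₁ ↑ʳ a) (s₁ ↑ʳ b) ≡ adj G₂ a b
  adj-rr a b rewrite splitAt-↑ʳ s₁ s₂ a | splitAt-↑ʳ s₁ s₂ b = refl

  adj-lr : ∀ a b → adj G (a ↑ˡ s₂) (s₁ ↑ʳ b) ≡ false
  adj-lr a b rewrite splitAt-↑ˡ s₁ a s₂ | splitAt-↑ʳ s₁ s₂ b = refl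

  adj-rl : ∀ a b → adj G (s₁ ↑ʳ a) (b ↑ˡ s₂) ≡ false
  adj-rl a b rewrite splitAt-↑ʳ s₁ s₂ a | splitAt-↑ˡ s₁ b s₂ = refl

  module _ (x y : Fin n) where
    hits : Fin n → Fin n → Bool
    hits p q = ((p == x) ∧ (q == y)) ∨ ((p == y) ∧ (q == x))

    counted : Fin (s₁ + s₂) → Fin (s₁ + s₂) → Bool
    counted u v = (toℕ u <ᵇ toℕ v) ∧ adj G u v ∧ hits (f u) (f v)

    counted₁ : Fin s₁ → Fin s₁ → Bool
    counted₁ u v = (toℕ u <ᵇ toℕ v) ∧ adj G₁ u v ∧ hits (f₁ u) (f₁ v)

    counted₂ : Fin s₂ → Fin s₂ → Bool
    counted₂ u v = (toℕ u <ᵇ toℕ v) ∧ adj G₂ u v ∧ hits (f₂ u) (f₂ v)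

    -- a vertex of G₁ only has neighbours in G₁
    row₁ : ∀ a → count (s₁ + s₂) (counted (a ↑ˡ s₂)) ≡ count s₁ (counted₁ a)
    row₁ a = begin
      count (s₁ + s₂) (counted (a ↑ˡ s₂))
        ≡⟨ count-+ s₁ s₂ (counted (a ↑ˡ s₂)) ⟩
      count s₁ (λ b → counted (a ↑ˡ s₂) (b ↑ˡ s₂)) + count s₂ (λ b → counted (a ↑ˡ s₂) (s₁ ↑ʳ b))
        ≡⟨ cong₂ _+_ (count-cong s₁ same) (count-false s₂ cross) ⟩
      count s₁ (counted₁ a) + 0
        ≡⟨ +-identityʳ _ ⟩
      count s₁ (counted₁ a) ∎
      where
      open ≡-Reasoning
      same : ∀ b → counted (a ↑ˡ s₂) (b ↑ˡ s₂) ≡ counted₁ a b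
      same b rewrite toℕ-↑ˡ a s₂ | toℕ-↑ˡ b s₂ | adj-ll a b = refl
      cross : ∀ b → counted (a ↑ˡ s₂) (s₁ ↑ʳ b) ≡ false
      cross b rewrite adj-lr a b = ∧-zeroʳ _

    -- a vertex of G₂ only has neighbours in G₂
    row₂ : ∀ a → count (s₁ + s₂) (counted (s₁ ↑ʳ a)) ≡ count s₂ (counted₂ a)
    row₂ a = begin
      count (s₁ + s₂) (counted (s₁ ↑ʳ a))
        ≡⟨ count-+ s₁ s₂ (counted (s₁ ↑ʳ a)) ⟩
      count s₁ (λ b → counted (s₁ ↑ʳ a) (b ↑ˡ s₂)) + count s₂ (λ b → counted (s₁ ↑ʳ a) (s₁ ↑ʳ b))
        ≡⟨ cong₂ _+_ (count-false s₁ cross) (count-cong s₂ same) ⟩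
      count s₂ (counted₂ a) ∎
      where
      open ≡-Reasoning
      same : ∀ b → counted (s₁ ↑ʳ a) (s₁ ↑ʳ b) ≡ counted₂ a b
      same b rewrite toℕ-↑ʳ s₁ a | toℕ-↑ʳ s₁ b | <ᵇ-+ s₁ (toℕ a) (toℕ b) | adj-rr a b = refl
      cross : ∀ b → counted (s₁ ↑ʳ a) (b ↑ˡ s₂) ≡ false
      cross b rewrite adj-rl a b = ∧-zeroʳ _

    edgeCount-split : edgeCount G f x y ≡ edgeCount G₁ f₁ x y + edgeCount G₂ f₂ x y
    edgeCount-split = trans (sumF-+ s₁ s₂ (λ u → count (s₁ + s₂) (counted u)))
                            (cong₂ _+_ (sumF-cong s₁ row₁) (sumF-cong s₂ row₂))

  image-split : ∀ x → anyF (s₁ + s₂) (λ u → f u == x) ≡ (inI₁ x ∨ inI₂ x)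
  image-split x = anyF-+ s₁ s₂ (λ u → f u == x)

  image-inclusion-exclusion :
    imageSize G f + count n inBoth ≡ imageSize G₁ f₁ + imageSize G₂ f₂
  image-inclusion-exclusion =
    trans (cong (_+ count n inBoth) (count-cong n image-split)) (count-∨∧ n inI₁ inI₂)

  odd-agree₁ : ∀ x → inI₂ x ≡ false → isOddVertex G f x ≡ isOddVertex G₁ f₁ x
  odd-agree₁ x x∉I₂ = anyF-cong n λ y → cong (λ e → not (x == y) ∧ (e % 2 ≡ᵇ 1)) (begin
      edgeCount G f x y                             ≡⟨ edgeCount-split x y ⟩
      edgeCount G₁ f₁ x y + edgeCount G₂ f₂ x y     ≡⟨ cong (edgeCount G₁ f₁ x y +_) (OutsideImage.edgeCount-outside G₂ f₂ x x∉I₂ y) ⟩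
      edgeCount G₁ f₁ x y + 0                       ≡⟨ +-identityʳ _ ⟩
      edgeCount G₁ f₁ x y                           ∎)
    where open ≡-Reasoning

  odd-agree₂ : ∀ x → inI₁ x ≡ false → isOddVertex G f x ≡ isOddVertex G₂ f₂ x
  odd-agree₂ x x∉I₁ = anyF-cong n λ y → cong (λ e → not (x == y) ∧ (e % 2 ≡ᵇ 1)) (begin
      edgeCount G f x y                             ≡⟨ edgeCount-split x y ⟩
      edgeCount G₁ f₁ x y + edgeCount G₂ f₂ x y     ≡⟨ cong (_+ edgeCount G₂ f₂ x y) (OutsideImage.edgeCount-outside G₁ f₁ x x∉I₁ y) ⟩
      edgeCount G₂ f₂ x y                           ∎)
    where open ≡-Reasoning

  odd₁∨odd₂⇒odd∨inBoth : (λ x → isOddVertex G₁ f₁ x ∨ isOddVertex G₂ f₂ x)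
                        ⇒ᵇ (λ x → isOddVertex G f x ∨ inBoth x)
  odd₁∨odd₂⇒odd∨inBoth x odd with inI₁ x in e₁ | inI₂ x in e₂
  ... | true  | true  = ∨-zeroʳ _
  ... | i₁    | false = begin
      isOddVertex G f x ∨ (i₁ ∧ false)                  ≡⟨ cong (isOddVertex G f x ∨_) (∧-zeroʳ i₁) ⟩
      isOddVertex G f x ∨ false                         ≡⟨ ∨-identityʳ _ ⟩
      isOddVertex G f x                                 ≡⟨ odd-agree₁ x e₂ ⟩
      isOddVertex G₁ f₁ x                               ≡⟨ sym (∨-identityʳ _) ⟩
      isOddVertex G₁ f₁ x ∨ false                       ≡⟨ cong (isOddVertex G₁ f₁ x ∨_) (sym (OutsideImage.notOdd-outside G₂ f₂ x e₂)) ⟩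
      isOddVertex G₁ f₁ x ∨ isOddVertex G₂ f₂ x        ≡⟨ odd ⟩
      true                                              ∎
    where open ≡-Reasoning
  ... | false | true  = begin
      isOddVertex G f x ∨ false                         ≡⟨ ∨-identityʳ _ ⟩
      isOddVertex G f x                                 ≡⟨ odd-agree₂ x e₁ ⟩
      isOddVertex G₂ f₂ x                               ≡⟨ cong (_∨ isOddVertex G₂ f₂ x) (sym (OutsideImage.notOdd-outside G₁ f₁ x e₁)) ⟩
      isOddVertex G₁ f₁ x ∨ isOddVertex G₂ f₂ x        ≡⟨ odd ⟩
      true                                              ∎
    where open ≡-Reasoning

  odd₁∧odd₂⇒inBoth : (λ x → isOddVertex G₁ f₁ x ∧ isOddVertex G₂ f₂ x)
                    ⇒ᵇ inBoth
  odd₁∧odd₂⇒inBoth x odd with isOddVertex G₁ f₁ x in o₁ | isOddVertex G₂ f₂ x in o₂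
  ... | true | true rewrite odd⇒inImage G₁ f₁ x o₁ | odd⇒inImage G₂ f₂ x o₂ = refl

  odd-bound : numOdd G₁ f₁ + numOdd G₂ f₂ ≤ numOdd G f + 2 * count n inBoth
  odd-bound = begin
    count n o₁ + count n o₂
      ≡⟨ sym (count-∨∧ n o₁ o₂) ⟩
    count n (λ x → o₁ x ∨ o₂ x) + count n (λ x → o₁ x ∧ o₂ x)
      ≤⟨ +-mono-≤ (count-mono n odd₁∨odd₂⇒odd∨inBoth) (count-mono n odd₁∧odd₂⇒inBoth) ⟩
    count n (λ x → o x ∨ inBoth x) + count n inBoth
      ≤⟨ +-monoˡ-≤ (count n inBoth) (count-∨ n o inBoth) ⟩
    count n o + count n inBoth + count n inBoth
      ≡⟨ +-assoc (count n o) _ _ ⟩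
    count n o + (count n inBoth + count n inBoth)
      ≡⟨ cong (count n o +_) (cong (count n inBoth +_) (sym (+-identityʳ _))) ⟩
    count n o + 2 * count n inBoth ∎
    where
    open ≤-Reasoning
    o o₁ o₂ : Fin n → Bool
    o = isOddVertex G f
    o₁ = isOddVertex G₁ f₁
    o₂ = isOddVertex G₂ f₂

defect-split : ∀ {s₁ s₂ i₁ i₂ i c} → i₁ ≤ s₁ → i₂ ≤ s₂ → i + c ≡ i₁ + i₂ →
  (s₁ ∸ i₁) + (s₂ ∸ i₂) + c ≡ (s₁ + s₂) ∸ i
defect-split {i₁ = i₁} {i₂} {i} {c} i₁≤s₁ i₂≤s₂ e
  with m≤n⇒∃[o]m+o≡n i₁≤s₁ | m≤n⇒∃[o]m+o≡n i₂≤s₂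
... | d₁ , refl | d₂ , refl = begin
  (i₁ + d₁ ∸ i₁) + (i₂ + d₂ ∸ i₂) + c
    ≡⟨ cong₂ (λ a b → a + b + c) (m+n∸m≡n i₁ d₁) (m+n∸m≡n i₂ d₂) ⟩
  d₁ + d₂ + c
    ≡⟨ sym (m+n∸m≡n i (d₁ + d₂ + c)) ⟩
  i + (d₁ + d₂ + c) ∸ i
    ≡⟨ cong (_∸ i) total ⟩
  (i₁ + d₁ + (i₂ + d₂)) ∸ i ∎
  where
  open ≡-Reasoning
  open +-*-Solver
  total : i + (d₁ + d₂ + c) ≡ i₁ + d₁ + (i₂ + d₂)
  total = begin
    i + (d₁ + d₂ + c)     ≡⟨ solve 4 (λ i c d₁ d₂ → i :+ (d₁ :+ d₂ :+ c) := (i :+ c) :+ (d₁ :+ d₂)) refl i c d₁ d₂ ⟩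
    (i + c) + (d₁ + d₂)   ≡⟨ cong (_+ (d₁ + d₂)) e ⟩
    (i₁ + i₂) + (d₁ + d₂) ≡⟨ solve 4 (λ i₁ i₂ d₁ d₂ → (i₁ :+ i₂) :+ (d₁ :+ d₂) := i₁ :+ d₁ :+ (i₂ :+ d₂)) refl i₁ i₂ d₁ d₂ ⟩
    i₁ + d₁ + (i₂ + d₂)   ∎

twiceR-superadditive : ∀ {s₁ s₂ i₁ i₂ i c o o₁ o₂} → i₁ ≤ s₁ → i₂ ≤ s₂ → i + c ≡ i₁ + i₂ →
  o₁ + o₂ ≤ o + 2 * c →
  2 * (s₁ ∸ i₁) + o₁ + (2 * (s₂ ∸ i₂) + o₂) ≤ 2 * ((s₁ + s₂) ∸ i) + o
twiceR-superadditive {s₁} {s₂} {i₁} {i₂} {i} {c} {o} {o₁} {o₂} i₁≤s₁ i₂≤s₂ e odd≤ = begin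
  2 * a + o₁ + (2 * b + o₂)
    ≡⟨ solve 4 (λ a b o₁ o₂ → con 2 :* a :+ o₁ :+ (con 2 :* b :+ o₂) := con 2 :* (a :+ b) :+ (o₁ :+ o₂)) refl a b o₁ o₂ ⟩
  2 * (a + b) + (o₁ + o₂)
    ≤⟨ +-monoʳ-≤ (2 * (a + b)) odd≤ ⟩
  2 * (a + b) + (o + 2 * c)
    ≡⟨ solve 4 (λ a b o c → con 2 :* (a :+ b) :+ (o :+ con 2 :* c) := con 2 :* (a :+ b :+ c) :+ o) refl a b o c ⟩
  2 * (a + b + c) + o
    ≡⟨ cong (λ d → 2 * d + o) (defect-split i₁≤s₁ i₂≤s₂ e) ⟩
  2 * ((s₁ + s₂) ∸ i) + o ∎
  where
  open ≤-Reasoning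
  open +-*-Solver
  a b : ℕ
  a = s₁ ∸ i₁
  b = s₂ ∸ i₂

-- The theorem

mainTheorem16 : (G₁ G₂ : Graph) (n : ℕ) → n ≥ size G₁ + size G₂ →
    (f : Fin (size (G₁ ⊕ G₂)) → Fin n) → IsHom (G₁ ⊕ G₂) n f →
    twiceR (G₁ ⊕ G₂) f ≥ twiceR G₁ (restrict₁ G₁ G₂ f) + twiceR G₂ (restrict₂ G₁ G₂ f)
mainTheorem16 G₁ G₂ n _ f _ =
  twiceR-superadditive {i = imageSize G f} {c = count n inBoth} {o = numOdd G f}
                       (image-bound n (size G₁) f₁) (image-bound n (size G₂) f₂)
                       image-inclusion-exclusion odd-bound
  where open DisjointUnion G₁ G₂ f
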